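{- Let $G$ be a finite connected cubic graph. Then the following are equivalent: (i) $\mathrm{Fl}\,G$ is distributive; (ii) $\mathrm{Fl}\,G$ is modular; (iii) $\mathrm{Fl}\,G$ is semimodular; (iv) $\mathrm{Fl}\,G$ is geometric; (v) $G\cong K_4$ or $G\cong K_{3,3}$.
   Context: Graphs are finite, undirected, without loops or multiple edges; cubic means every vertex has degree 3. $\mathrm{St}(v)$ is the set of neighbours of $v$, $\mathrm{St}(W)=\bigcap_{w\in W}\mathrm{St}(w)$ with $\mathrm{St}(\emptyset)=V$, and $\mathrm{Fl}\,G=\{\mathrm{St}(W)\mid W\subseteq V\}$ ordered by inclusion; it is a lattice with meet $\cap$ and join of $X,Y$ the smallest flat containing $X\cup Y$. A lattice is distributive if $p\wedge(q\vee r)=(p\wedge q)\vee(p\wedge r)$ for all $p,q,r$. It is modular if it has no sublattice consisting of five distinct elements $a,b,c,d,e$ with $e<c<b<a$, $e<d<a$, $b\vee d=c\vee d=a$, $b\wedge d=c\wedge d=e$; it is semimodular if it has no such sublattice in which $d$ covers $e$. An atom is an element covering the minimum; a lattice is geometric if it is semimodular and every element is a join of atoms (the minimum being the empty join). -}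

module Defs where

open import Data.Nat using (ℕ; _<ᵇ_)
open import Data.Bool using (Bool; true; false; not; _xor_)
open import Data.Fin using (Fin; toℕ; _≟_)
open import Data.Fin.Subset using (Subset; _∈_; _⊆_; _∪_; ∣_∣)
open import Data.Vec using (tabulate)
open import Data.List using (List)
open import Data.List.Relation.Unary.All using (All)
open import Data.Product using (Σ; ∃; _×_)
open import Relation.Nullary using (¬_; does)
open import Relation.Binary.PropositionalEquality using (_≡_; _≢_; refl; sym)
open import Relation.Nullary using (yes; no)
open import Data.Empty using (⊥-elim)
open import Data.Sum using (_⊎_)
open import Data.Bool.Properties using (xor-comm)
open import Function.Bundles using (_⇔_; _↔_; Inverse)

record Graph (n : ℕ) : Set where
  field
    adj    : Fin n → Fin n → Bool
    adj-sym : ∀ u v → adj u v ≡ adj v u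
    adj-irrefl : ∀ v → adj v v ≡ false
open Graph public

module _ {n : ℕ} (G : Graph n) where

  Adj : Fin n → Fin n → Set
  Adj u v = adj G u v ≡ true

  Nbhd : Fin n → Subset n
  Nbhd v = tabulate (adj G v)

  Cubic : Set
  Cubic = ∀ v → ∣ Nbhd v ∣ ≡ 3

  data Walk : Fin n → Fin n → Set where
    here : ∀ {v} → Walk v v
    step : ∀ {u v w} → Adj u v → Walk v w → Walk u w

  -- connected graphs are nonempty
  Connected : Set
  Connected = Fin n × (∀ u v → Walk u v)

  -- X = St(W) = ⋂_{w ∈ W} St(w)   (St(∅) = V)
  IsSt : Subset n → Subset n → Set
  IsSt W X = ∀ x → (x ∈ X ⇔ (∀ w → w ∈ W → Adj w x))

  IsFlat : Subset n → Set
  IsFlat X = ∃ λ W → IsSt W X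

  _⊊_ : Subset n → Subset n → Set
  X ⊊ Y = X ⊆ Y × X ≢ Y

  IsMeet : Subset n → Subset n → Subset n → Set
  IsMeet X Y Z = IsFlat Z × Z ⊆ X × Z ⊆ Y
               × (∀ F → IsFlat F → F ⊆ X → F ⊆ Y → F ⊆ Z)

  IsJoin : Subset n → Subset n → Subset n → Set
  IsJoin X Y Z = IsFlat Z × (X ∪ Y) ⊆ Z
               × (∀ F → IsFlat F → (X ∪ Y) ⊆ F → Z ⊆ F)

  IsJoinOf : List (Subset n) → Subset n → Set
  IsJoinOf Xs Z = IsFlat Z × All (_⊆ Z) Xs
                × (∀ F → IsFlat F → All (_⊆ F) Xs → Z ⊆ F)

  IsBottom : Subset n → Set
  IsBottom X = IsFlat X × (∀ F → IsFlat F → X ⊆ F)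

  Covers : Subset n → Subset n → Set
  Covers Y X = IsFlat X × IsFlat Y × X ⊊ Y
             × (∀ F → IsFlat F → X ⊆ F → F ⊆ Y → F ≡ X ⊎ F ≡ Y)

  IsAtom : Subset n → Set
  IsAtom X = Σ (Subset n) λ B → IsBottom B × Covers X B

  Distributive : Set
  Distributive = ∀ p q r s t u v w →
    IsFlat p → IsFlat q → IsFlat r →
    IsJoin q r s → IsMeet p s t →
    IsMeet p q u → IsMeet p r v → IsJoin u v w → t ≡ w

  record Pentagon (a b c d e : Subset n) : Set where
    field
      fa : IsFlat a
      fb : IsFlat b
      fc : IsFlat c
      fd : IsFlat d
      fe : IsFlat e
      e<c : e ⊊ c
      c<b : c ⊊ b
      b<a : b ⊊ a
      e<d : e ⊊ d
      d<a : d ⊊ a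
      d≢b : d ≢ b
      d≢c : d ≢ c
      b∨d : IsJoin b d a
      c∨d : IsJoin c d a
      b∧d : IsMeet b d e
      c∧d : IsMeet c d e

  Modular : Set
  Modular = ¬ (∃ λ a → ∃ λ b → ∃ λ c → ∃ λ d → ∃ λ e → Pentagon a b c d e)

  Semimodular : Set
  Semimodular = ¬ (∃ λ a → ∃ λ b → ∃ λ c → ∃ λ d → ∃ λ e →
                     Pentagon a b c d e × Covers d e)

  Geometric : Set
  Geometric = Semimodular ×
    (∀ X → IsFlat X → ∃ λ (As : List (Subset n)) → All IsAtom As × IsJoinOf As X)

_≅_ : ∀ {n m} → Graph n → Graph m → Set
_≅_ {n} {m} G H = Σ (Fin n ↔ Fin m) λ φ →
  ∀ u v → adj G u v ≡ adj H (Inverse.to φ u) (Inverse.to φ v)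

K4 : Graph 4
K4 = record { adj = λ u v → not (does (u ≟ v)) ; adj-sym = s ; adj-irrefl = i }
  where
  s : ∀ (u v : Fin 4) → not (does (u ≟ v)) ≡ not (does (v ≟ u))
  s u v with u ≟ v | v ≟ u
  ... | yes _ | yes _ = refl
  ... | no _  | no _  = refl
  ... | yes p | no q  = ⊥-elim (q (sym p))
  ... | no p  | yes q = ⊥-elim (p (sym q))
  i : ∀ (v : Fin 4) → not (does (v ≟ v)) ≡ false
  i v with v ≟ v
  ... | yes _ = refl
  ... | no ¬p = ⊥-elim (¬p refl)

-- complete bipartite graph K_{3,3} on Fin 6, parts {0,1,2} and {3,4,5}
K33 : Graph 6
K33 = record { adj = λ u v → side u xor side v ; adj-sym = λ u v → xor-comm (side u) (side v) ; adj-irrefl = i }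
  where
  side : Fin 6 → Bool
  side u = toℕ u <ᵇ 3
  i : ∀ v → side v xor side v ≡ false
  i v with side v
  ... | true = refl
  ... | false = refl

module Submission where

-- Distributive ⇒ modular ⇒ semimodular holds in every lattice.  For the
-- converse direction, K₄ and K₃,₃ are complete multipartite graphs, and in such a
-- graph the flats are exactly the unions of parts; so Fl G is closed under unions,
-- its joins are unions and it is distributive.  In a cubic graph the closure
-- cl x = St(St x) of a vertex is the set of vertices with the same neighbourhood as
-- x; it is an atom, and every flat is the join of the closures of its elements, so a
-- union-closed Fl G is also geometric.  Finally let Fl G be semimodular.  If two
-- vertices x, y have no common neighbour, pick z ~ y: either some neighbour u of z
-- lies outside cl y, and then ⊤ > N(z) > cl y > ⊥ with the atom cl x is a forbidden
-- pentagon, or N(z) ⊆ cl y and G is K₃,₃ with sides N(z), N(y).  If any two vertices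
-- have a common neighbour, every edge lies in a triangle, which forces G to be
-- complete, hence K₄.

open import Data.Nat using (ℕ; zero; suc; _∸_; _<ᵇ_)
open import Data.Nat.Properties using (suc-injective; 0≢1+n; <-irrefl)
open import Data.Bool using (Bool; true; false; _xor_)
open import Data.Bool.Properties using () renaming (_≟_ to _≟ᵇ_)
open import Data.Fin using (Fin; zero; suc; toℕ; _≟_; splitAt; join)
open import Data.Fin.Properties using (any?; all?; ¬∀⟶∃¬; splitAt-join; join-splitAt)
open import Data.Fin.Subset
  using (Subset; _∈_; _∉_; _⊆_; ∣_∣; inside; outside; Nonempty; ⊥; ⊤; ⁅_⁆; _∪_; _∩_; ∁; _-_)
open import Data.Fin.Subset.Properties
  using ( _∈?_; nonempty?; Empty-unique; ∣⊥∣≡0; p⊂q⇒∣p∣<∣q∣; ∣∁p∣≡n∸∣p∣; ∣⁅x⁆∣≡1; p─⊥≡p; p─q⊆p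
        ; x∈p∧x≢y⇒x∈p-y; x∈⁅x⁆; x∈⁅y⁆⇒x≡y; x≢y⇒x∉⁅y⁆; ∉⊥; ∈⊤; ⊆-refl; ⊆-antisym; ⊆-min; ⊆-max
        ; x∈p∪q⁺; x∈p∪q⁻; x∈p∩q⁺; x∈p∩q⁻; x∈∁p⇒x∉p; x∉p⇒x∈∁p; ∩-distribˡ-∪ )
open import Data.Vec using (_∷_; tabulate; here; there)
open import Data.Vec.Properties using (lookup∘tabulate; []=⇒lookup; lookup⇒[]=)
open import Data.Product using (∃; _×_; _,_; proj₁; proj₂)
import Data.Product
open import Data.Sum using (_⊎_; inj₁; inj₂; [_,_]′)
import Data.Sum
open import Data.Empty using (⊥-elim)
open import Data.List using (List; map; filter; allFin)
open import Data.List.Membership.Propositional.Properties using (∈-filter⁺; ∈-filter⁻; ∈-allFin)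
open import Data.List.Relation.Unary.All using (universal) renaming (tabulate to tabulateᴬ; lookup to lookupᴬ)
open import Data.List.Relation.Unary.All.Properties using (map⁺; map⁻)
open import Function using (_∘_; id)
open import Function.Bundles using (_⇔_; _↔_; mk⇔; Equivalence; Inverse; mk↔ₛ′)
open import Relation.Nullary using (¬_; Dec; yes; no; does)
open import Relation.Nullary.Decidable using (_→-dec_; _×-dec_; ¬?; decidable-stable; dec-true; dec-false)
open import Relation.Binary.PropositionalEquality
  using (_≡_; _≢_; refl; sym; trans; cong; cong₂; subst; module ≡-Reasoning)
open import Defs

size-remove : ∀ {n} {x : Fin n} {p : Subset n} → x ∈ p → ∣ p ∣ ≡ suc ∣ p - x ∣
size-remove {x = zero}  {inside ∷ p}  here        = cong (suc ∘ ∣_∣) (sym (p─⊥≡p p))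
size-remove {x = suc x} {inside ∷ p}  (there x∈p) = cong suc (size-remove x∈p)
size-remove {x = suc x} {outside ∷ p} (there x∈p) = size-remove x∈p

∉-remove : ∀ {n} {x y : Fin n} (p : Subset n) → x ∈ p - y → x ≢ y
∉-remove {x = zero}  {zero}  (inside ∷ p) () refl
∉-remove {x = suc x} {suc y} (_ ∷ p) (there x∈p-y) refl = ∉-remove p x∈p-y refl

member : ∀ {n k} (p : Subset n) → ∣ p ∣ ≡ suc k → Nonempty p
member {n} p size with nonempty? p
... | yes p≠∅ = p≠∅
... | no  p=∅ = ⊥-elim (0≢1+n (begin
      0           ≡⟨ sym (∣⊥∣≡0 n) ⟩
      ∣ ⊥ {n} ∣   ≡⟨ cong ∣_∣ (sym (Empty-unique p=∅)) ⟩
      ∣ p ∣       ≡⟨ size ⟩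
      suc _       ∎))
  where open ≡-Reasoning

⊆-size-eq : ∀ {n} {p q : Subset n} → p ⊆ q → ∣ p ∣ ≡ ∣ q ∣ → q ⊆ p
⊆-size-eq {p = p} p⊆q size {x} x∈q with x ∈? p
... | yes x∈p = x∈p
... | no  x∉p = ⊥-elim (<-irrefl size (p⊂q⇒∣p∣<∣q∣ (p⊆q , x , x∈q , x∉p)))

record Enumeration {n : ℕ} (p : Subset n) : Set where
  field
    elem      : Fin 3 → Fin n
    injective : ∀ {i j} → elem i ≡ elem j → i ≡ j
    elem∈     : ∀ i → elem i ∈ p
    covers    : ∀ {x} → x ∈ p → ∃ λ i → elem i ≡ x

module _ {n : ℕ} {p : Subset n} (size : ∣ p ∣ ≡ 3) where

  remove-two : ∀ {a b} → a ∈ p → b ∈ p → a ≢ b → ∣ p - a - b ∣ ≡ 1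
  remove-two a∈p b∈p a≢b =
    suc-injective (trans (sym (size-remove (x∈p∧x≢y⇒x∈p-y b∈p (a≢b ∘ sym))))
      (suc-injective (trans (sym (size-remove a∈p)) size)))

  third : ∀ {a b} → a ∈ p → b ∈ p → a ≢ b → ∃ λ c → c ∈ p × a ≢ c × b ≢ c
  third {a} {b} a∈p b∈p a≢b with member (p - a - b) (remove-two a∈p b∈p a≢b)
  ... | c , c∈ = c , p─q⊆p p _ (p─q⊆p (p - a) _ c∈)
               , (λ a≡c → ∉-remove p (p─q⊆p (p - a) _ c∈) (sym a≡c))
               , (λ b≡c → ∉-remove (p - a) c∈ (sym b≡c))

  only-three : ∀ {a b c w} → a ∈ p → b ∈ p → c ∈ p → a ≢ b → a ≢ c → b ≢ c →
               w ∈ p → w ≡ a ⊎ w ≡ b ⊎ w ≡ c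
  only-three {a} {b} {c} {w} a∈p b∈p c∈p a≢b a≢c b≢c w∈p with w ≟ a | w ≟ b | w ≟ c
  ... | yes w≡a | _       | _       = inj₁ w≡a
  ... | no  _   | yes w≡b | _       = inj₂ (inj₁ w≡b)
  ... | no  _   | no  _   | yes w≡c = inj₂ (inj₂ w≡c)
  ... | no  w≢a | no  w≢b | no  w≢c = ⊥-elim (0≢1+n (suc-injective (begin
      1                         ≡⟨ sym (remove-two a∈p b∈p a≢b) ⟩
      ∣ p - a - b ∣             ≡⟨ size-remove c∈p-a-b ⟩
      suc ∣ p - a - b - c ∣     ≡⟨ cong suc (size-remove w∈p-a-b-c) ⟩
      suc (suc _)               ∎)))
    where
    open ≡-Reasoning
    c∈p-a-b : c ∈ p - a - b
    c∈p-a-b = x∈p∧x≢y⇒x∈p-y (x∈p∧x≢y⇒x∈p-y c∈p (a≢c ∘ sym)) (b≢c ∘ sym)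
    w∈p-a-b-c : w ∈ p - a - b - c
    w∈p-a-b-c = x∈p∧x≢y⇒x∈p-y (x∈p∧x≢y⇒x∈p-y (x∈p∧x≢y⇒x∈p-y w∈p w≢a) w≢b) w≢c

  listing : ∀ {a b} → a ∈ p → b ∈ p → a ≢ b → Enumeration p
  listing {a} {b} a∈p b∈p a≢b with third a∈p b∈p a≢b
  ... | c , c∈p , a≢c , b≢c = record
    { elem = elem ; injective = injective ; elem∈ = elem∈ ; covers = covers }
    where
    elem : Fin 3 → Fin n
    elem zero             = a
    elem (suc zero)       = b
    elem (suc (suc zero)) = c
    elem∈ : ∀ i → elem i ∈ p
    elem∈ zero             = a∈p
    elem∈ (suc zero)       = b∈p
    elem∈ (suc (suc zero)) = c∈p
    injective : ∀ {i j} → elem i ≡ elem j → i ≡ j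
    injective {zero}           {zero}           _ = refl
    injective {zero}           {suc zero}       e = ⊥-elim (a≢b e)
    injective {zero}           {suc (suc zero)} e = ⊥-elim (a≢c e)
    injective {suc zero}       {zero}           e = ⊥-elim (a≢b (sym e))
    injective {suc zero}       {suc zero}       _ = refl
    injective {suc zero}       {suc (suc zero)} e = ⊥-elim (b≢c e)
    injective {suc (suc zero)} {zero}           e = ⊥-elim (a≢c (sym e))
    injective {suc (suc zero)} {suc zero}       e = ⊥-elim (b≢c (sym e))
    injective {suc (suc zero)} {suc (suc zero)} _ = refl
    covers : ∀ {x} → x ∈ p → ∃ λ i → elem i ≡ x
    covers x∈p with only-three a∈p b∈p c∈p a≢b a≢c b≢c x∈p
    ... | inj₁ x≡a        = zero , sym x≡a
    ... | inj₂ (inj₁ x≡b) = suc zero , sym x≡b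
    ... | inj₂ (inj₂ x≡c) = suc (suc zero) , sym x≡c

  enumerate : Enumeration p
  enumerate with member p size
  ... | a , a∈p with member (p - a) (suc-injective (trans (sym (size-remove a∈p)) size))
  ... | b , b∈p-a = listing a∈p (p─q⊆p p _ b∈p-a) (λ a≡b → ∉-remove p b∈p-a (sym a≡b))

∈-tabulate⁺ : ∀ {n} (f : Fin n → Bool) {x} → f x ≡ true → x ∈ tabulate f
∈-tabulate⁺ f {x} fx = lookup⇒[]= x (tabulate f) (trans (lookup∘tabulate f x) fx)

∈-tabulate⁻ : ∀ {n} (f : Fin n → Bool) {x} → x ∈ tabulate f → f x ≡ true
∈-tabulate⁻ f {x} x∈ = trans (sym (lookup∘tabulate f x)) ([]=⇒lookup x∈)

bool-ext : ∀ {a b : Bool} → (a ≡ true ⇔ b ≡ true) → a ≡ b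
bool-ext {true}  {true}  _   = refl
bool-ext {false} {false} _   = refl
bool-ext {true}  {false} a⇔b = sym (Equivalence.to a⇔b refl)
bool-ext {false} {true}  a⇔b = Equivalence.from a⇔b refl

xor⇔≢ : ∀ x y → x xor y ≡ true ⇔ x ≢ y
xor⇔≢ true  true  = mk⇔ (λ ()) (λ t≢t → ⊥-elim (t≢t refl))
xor⇔≢ true  false = mk⇔ (λ _ ()) (λ _ → refl)
xor⇔≢ false true  = mk⇔ (λ _ ()) (λ _ → refl)
xor⇔≢ false false = mk⇔ (λ ()) (λ f≢f → ⊥-elim (f≢f refl))

does⇒ : ∀ {P : Set} (P? : Dec P) → does P? ≡ true → P
does⇒ (yes p) _ = p

module _ {n : ℕ} (G : Graph n) where

  nbr⁺ : ∀ {v x} → Adj G v x → x ∈ Nbhd G v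
  nbr⁺ {v} = ∈-tabulate⁺ (adj G v)

  nbr⁻ : ∀ {v x} → x ∈ Nbhd G v → Adj G v x
  nbr⁻ {v} = ∈-tabulate⁻ (adj G v)

  Adj-sym : ∀ {u v} → Adj G u v → Adj G v u
  Adj-sym {u} {v} u~v = trans (adj-sym G v u) u~v

  Adj-irrefl : ∀ {v} → ¬ Adj G v v
  Adj-irrefl {v} v~v with trans (sym (adj-irrefl G v)) v~v
  ... | ()

  Adj⇒≢ : ∀ {u v} → Adj G u v → u ≢ v
  Adj⇒≢ u~v refl = Adj-irrefl u~v

  Adj? : ∀ u v → Dec (Adj G u v)
  Adj? u v = adj G u v ≟ᵇ true

  St : Subset n → Subset n
  St W = tabulate λ x → does (all? λ w → (w ∈? W) →-dec Adj? w x)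

  St-isSt : ∀ W → IsSt G W (St W)
  St-isSt W x = mk⇔ (does⇒ (all? _) ∘ ∈-tabulate⁻ _) (∈-tabulate⁺ _ ∘ dec-true (all? _))

  st⁻ : ∀ {W X x w} → IsSt G W X → x ∈ X → w ∈ W → Adj G w x
  st⁻ {x = x} s x∈X w∈W = Equivalence.to (s x) x∈X _ w∈W

  st⁺ : ∀ {W X x} → IsSt G W X → (∀ w → w ∈ W → Adj G w x) → x ∈ X
  st⁺ {x = x} s all = Equivalence.from (s x) all

  ⊤-flat : IsFlat G ⊤
  ⊤-flat = ⊥ , λ x → mk⇔ (λ _ w w∈⊥ → ⊥-elim (∉⊥ w∈⊥)) (λ _ → ∈⊤)

  -- ⊥ = St(V), since the graph has no loops.
  ⊥-flat : IsFlat G ⊥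
  ⊥-flat = ⊤ , λ x → mk⇔ (λ x∈⊥ → ⊥-elim (∉⊥ x∈⊥)) (λ all → ⊥-elim (Adj-irrefl (all x ∈⊤)))

  ⊥-bottom : IsBottom G ⊥
  ⊥-bottom = ⊥-flat , λ X _ x∈⊥ → ⊥-elim (∉⊥ x∈⊥)

  Nbhd-flat : ∀ z → IsFlat G (Nbhd G z)
  Nbhd-flat z = ⁅ z ⁆ , λ x → mk⇔
    (λ x∈N w w∈⁅z⁆ → subst (λ u → Adj G u x) (sym (x∈⁅y⁆⇒x≡y z w∈⁅z⁆)) (nbr⁻ x∈N))
    (λ all → nbr⁺ (all z (x∈⁅x⁆ z)))

  -- St(W₁) ∩ St(W₂) = St(W₁ ∪ W₂).
  ∩-flat : ∀ {X Y} → IsFlat G X → IsFlat G Y → IsFlat G (X ∩ Y)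
  ∩-flat {X} {Y} (W₁ , s₁) (W₂ , s₂) = W₁ ∪ W₂ , λ x → mk⇔
    (λ x∈X∩Y w w∈W → [ st⁻ s₁ (proj₁ (x∈p∩q⁻ X Y x∈X∩Y)) , st⁻ s₂ (proj₂ (x∈p∩q⁻ X Y x∈X∩Y)) ]′
                        (x∈p∪q⁻ W₁ W₂ w∈W))
    (λ all → x∈p∩q⁺ ( st⁺ s₁ (λ w w∈W₁ → all w (x∈p∪q⁺ (inj₁ w∈W₁)))
                     , st⁺ s₂ (λ w w∈W₂ → all w (x∈p∪q⁺ (inj₂ w∈W₂)))))

  -- The closure of a vertex x, i.e. the least flat containing x, is St(St(x)).
  cl : Fin n → Subset n
  cl x = St (Nbhd G x)

  cl-flat : ∀ {x} → IsFlat G (cl x)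
  cl-flat {x} = Nbhd G x , St-isSt (Nbhd G x)

  x∈cl : ∀ {x} → x ∈ cl x
  x∈cl = st⁺ (St-isSt _) (λ w w∈N → Adj-sym (nbr⁻ w∈N))

  cl-least : ∀ {F x} → IsFlat G F → x ∈ F → cl x ⊆ F
  cl-least (W , s) x∈F v∈cl =
    st⁺ s (λ w w∈W → st⁻ (St-isSt _) v∈cl (nbr⁺ (Adj-sym (st⁻ s x∈F w∈W))))

  cl-nbhd⊇ : ∀ {x v} → v ∈ cl x → Nbhd G x ⊆ Nbhd G v
  cl-nbhd⊇ v∈cl w∈N = nbr⁺ (Adj-sym (st⁻ (St-isSt _) v∈cl w∈N))

  nbr∉cl : ∀ {x w} → Adj G x w → w ∉ cl x
  nbr∉cl x~w w∈cl = Adj-irrefl (nbr⁻ (cl-nbhd⊇ w∈cl (nbr⁺ x~w)))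

  ⊊-witness : ∀ {X Y y} → X ⊆ Y → y ∈ Y → y ∉ X → _⊊_ G X Y
  ⊊-witness X⊆Y y∈Y y∉X = X⊆Y , λ X≡Y → y∉X (subst (_ ∈_) (sym X≡Y) y∈Y)

  meet-⊥ : ∀ {X Y} → (∀ {v} → v ∈ X → v ∉ Y) → IsMeet G X Y ⊥
  meet-⊥ disjoint = ⊥-flat , ⊆-min _ , ⊆-min _
                  , λ F _ F⊆X F⊆Y v∈F → ⊥-elim (disjoint (F⊆X v∈F) (F⊆Y v∈F))

  Separated : Fin n → Fin n → Set
  Separated x y = ∀ w → ¬ (Adj G x w × Adj G y w)

  -- Any flat containing two separated vertices is the whole vertex set,
  -- so two flats containing them have join ⊤.
  join-⊤ : ∀ {x y X Y} → Separated x y → x ∈ X → y ∈ Y → IsJoin G X Y ⊤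
  join-⊤ sep x∈X y∈Y = ⊤-flat , (λ _ → ∈⊤) , λ F (W , s) X∪Y⊆F _ →
    st⁺ s λ w w∈W → ⊥-elim (sep w ( Adj-sym (st⁻ s (X∪Y⊆F (x∈p∪q⁺ (inj₁ x∈X))) w∈W)
                                  , Adj-sym (st⁻ s (X∪Y⊆F (x∈p∪q⁺ (inj₂ y∈Y))) w∈W)))

  meet-is-∩ : ∀ {X Y Z} → IsFlat G X → IsFlat G Y → IsMeet G X Y Z → Z ≡ X ∩ Y
  meet-is-∩ {X} {Y} fX fY (_ , Z⊆X , Z⊆Y , greatest) = ⊆-antisym
    (λ z∈Z → x∈p∩q⁺ (Z⊆X z∈Z , Z⊆Y z∈Z))
    (greatest (X ∩ Y) (∩-flat fX fY) (proj₁ ∘ x∈p∩q⁻ X Y) (proj₂ ∘ x∈p∩q⁻ X Y))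

  -- The graphs whose flats are closed under unions, so that Fl G is a sublattice of
  -- the lattice of subsets.
  UnionClosed : Set
  UnionClosed = ∀ X Y → IsFlat G X → IsFlat G Y → IsFlat G (X ∪ Y)

  join-is-∪ : UnionClosed → ∀ {X Y Z} → IsFlat G X → IsFlat G Y → IsJoin G X Y Z → Z ≡ X ∪ Y
  join-is-∪ closed {X} {Y} fX fY (_ , X∪Y⊆Z , least) =
    ⊆-antisym (least (X ∪ Y) (closed X Y fX fY) ⊆-refl) X∪Y⊆Z

  -- A sublattice of a distributive lattice of sets is distributive.
  union-closed⇒distributive : UnionClosed → Distributive G
  union-closed⇒distributive closed p q r s t u v w fp fq fr q∨r p∧s p∧q p∧r u∨v = begin
    t               ≡⟨ meet-is-∩ fp (proj₁ q∨r) p∧s ⟩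
    p ∩ s           ≡⟨ cong (p ∩_) (join-is-∪ closed fq fr q∨r) ⟩
    p ∩ (q ∪ r)     ≡⟨ ∩-distribˡ-∪ p q r ⟩
    p ∩ q ∪ p ∩ r   ≡⟨ sym (cong₂ _∪_ (meet-is-∩ fp fq p∧q) (meet-is-∩ fp fr p∧r)) ⟩
    u ∪ v           ≡⟨ sym (join-is-∪ closed (proj₁ p∧q) (proj₁ p∧r) u∨v) ⟩
    w               ∎
    where open ≡-Reasoning

  -- In a pentagon a > b > c > e, a > d > e, distributivity applied to b, c, d forces
  -- b = b ∧ (c ∨ d) = (b ∧ c) ∨ (b ∧ d) = c ∨ e = c.
  distributive⇒modular : Distributive G → Modular G
  distributive⇒modular distrib (a , b , c , d , e , P) =
    proj₂ c<b (sym (distrib b c d a b c e c fb fc fd c∨d b∧a b∧c b∧d c∨e))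
    where
    open Pentagon P
    b∧a : IsMeet G b a b
    b∧a = fb , ⊆-refl , proj₁ b<a , λ _ _ F⊆b _ → F⊆b
    b∧c : IsMeet G b c c
    b∧c = fc , proj₁ c<b , ⊆-refl , λ _ _ _ F⊆c → F⊆c
    c∨e : IsJoin G c e c
    c∨e = fc , [ id , proj₁ e<c ]′ ∘ x∈p∪q⁻ c e , λ _ _ c∪e⊆F → c∪e⊆F ∘ x∈p∪q⁺ ∘ inj₁

  modular⇒semimodular : Modular G → Semimodular G
  modular⇒semimodular modular (a , b , c , d , e , P , _) = modular (a , b , c , d , e , P)

  Multipartite : {P : Set} → (Fin n → P) → Set
  Multipartite π = ∀ u v → Adj G u v ⇔ π u ≢ π v

  module _ {P : Set} {π : Fin n → P} (multipartite : Multipartite π) where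

    Saturated : Subset n → Set
    Saturated X = ∀ {u v} → π u ≡ π v → u ∈ X → v ∈ X

    flat⇒saturated : ∀ {X} → IsFlat G X → Saturated X
    flat⇒saturated (W , s) {u} {v} πu≡πv u∈X = st⁺ s λ w w∈W →
      Equivalence.from (multipartite w v) λ πw≡πv →
        Equivalence.to (multipartite w u) (st⁻ s u∈X w∈W) (trans πw≡πv (sym πu≡πv))

    -- A saturated set X equals St(St X): a vertex outside X is adjacent to all of X.
    saturated⇒flat : ∀ {X} → Saturated X → IsFlat G X
    saturated⇒flat {X} saturated = St X , λ x → mk⇔
      (λ x∈X w w∈StX → Adj-sym (st⁻ (St-isSt X) w∈StX x∈X))
      (λ all → decidable-stable (x ∈? X) λ x∉X → Adj-irrefl (all x (st⁺ (St-isSt X) λ y y∈X →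
         Equivalence.from (multipartite y x) λ πy≡πx → x∉X (saturated πy≡πx y∈X))))

    multipartite⇒union-closed : UnionClosed
    multipartite⇒union-closed X Y fX fY = saturated⇒flat λ πu≡πv u∈X∪Y →
      x∈p∪q⁺ (Data.Sum.map (flat⇒saturated fX πu≡πv) (flat⇒saturated fY πu≡πv) (x∈p∪q⁻ X Y u∈X∪Y))

  connected-induction : Connected G → ∀ {P : Fin n → Set} {x} → P x →
                        (∀ {u v} → P u → Adj G u v → P v) → ∀ v → P v
  connected-induction (_ , walk) {P} {x} Px inherit v = along (walk x v) Px
    where
    along : ∀ {u v} → Walk G u v → P u → P v
    along here        Pu = Pu
    along (step u~w w) Pu = along w (inherit Pu u~w)

  members : Subset n → List (Fin n)
  members X = filter (_∈? X) (allFin n)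

  flat-is-join-of-closures : ∀ {X} → IsFlat G X → IsJoinOf G (map cl (members X)) X
  flat-is-join-of-closures {X} fX =
      fX
    , map⁺ (tabulateᴬ λ x∈ → cl-least fX (proj₂ (∈-filter⁻ (_∈? X) {xs = allFin n} x∈)))
    , λ F _ cls⊆F x∈X → lookupᴬ (map⁻ cls⊆F) (∈-filter⁺ (_∈? X) (∈-allFin _) x∈X) x∈cl

module _ {n k : ℕ} (G : Graph n) (H : Graph k) where

  embedding-≅ : (f : Fin k → Fin n) → (∀ {i j} → f i ≡ f j → i ≡ j) → (∀ u → ∃ λ i → f i ≡ u) →
                (∀ i j → Adj G (f i) (f j) ⇔ Adj H i j) → G ≅ H
  embedding-≅ f injective surjective adj⇔ = φ , λ u v → begin
      adj G u v                      ≡⟨ sym (cong₂ (adj G) (f∘g u) (f∘g v)) ⟩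
      adj G (f (g u)) (f (g v))      ≡⟨ bool-ext (adj⇔ (g u) (g v)) ⟩
      adj H (g u) (g v)              ∎
    where
    open ≡-Reasoning
    g : Fin n → Fin k
    g = proj₁ ∘ surjective
    f∘g : ∀ u → f (g u) ≡ u
    f∘g = proj₂ ∘ surjective
    φ : Fin n ↔ Fin k
    φ = mk↔ₛ′ g f (λ i → injective (f∘g (f i))) f∘g

  multipartite-pullback : (iso : G ≅ H) → ∀ {P : Set} {ρ : Fin k → P} → Multipartite H ρ →
                          Multipartite G (ρ ∘ Inverse.to (proj₁ iso))
  multipartite-pullback (φ , adj≡) mp u v = mk⇔
    (Equivalence.to (mp _ _) ∘ trans (sym (adj≡ u v)))
    (trans (adj≡ u v) ∘ Equivalence.from (mp _ _))

  multipartite-≅ : ∀ {P : Set} {π : Fin n → P} {ρ : Fin k → P} → Multipartite G π → Multipartite H ρ →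
                   (f : Fin k → Fin n) → (∀ {i j} → f i ≡ f j → i ≡ j) → (∀ u → ∃ λ i → f i ≡ u) →
                   (∀ i → π (f i) ≡ ρ i) → G ≅ H
  multipartite-≅ {π = π} {ρ} mpG mpH f injective surjective parts =
    embedding-≅ f injective surjective λ i j → mk⇔
      (λ fi~fj → Equivalence.from (mpH i j) (Equivalence.to (mpG (f i) (f j)) fi~fj ∘ π∘f≡ρ))
      (λ i~j → Equivalence.from (mpG (f i) (f j)) (Equivalence.to (mpH i j) i~j ∘ ρ≡π∘f))
    where
    π∘f≡ρ : ∀ {i j} → ρ i ≡ ρ j → π (f i) ≡ π (f j)
    π∘f≡ρ {i} {j} eq = trans (parts i) (trans eq (sym (parts j)))
    ρ≡π∘f : ∀ {i j} → π (f i) ≡ π (f j) → ρ i ≡ ρ j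
    ρ≡π∘f {i} {j} eq = trans (sym (parts i)) (trans eq (parts j))

K4-multipartite : Multipartite K4 id
K4-multipartite i j with i ≟ j
... | yes i≡j = mk⇔ (λ ()) (λ i≢j → ⊥-elim (i≢j i≡j))
... | no  i≢j = mk⇔ (λ _ → i≢j) (λ _ → refl)

side : Fin 6 → Bool
side i = toℕ i <ᵇ 3

K33-multipartite : Multipartite K33 side
K33-multipartite i j = xor⇔≢ (side i) (side j)

-- K₃,₃ has vertex set Fin 3 ⊎ Fin 3, split along the sides.
part : Fin 3 ⊎ Fin 3 → Bool
part = [ (λ _ → true) , (λ _ → false) ]′

side-splitAt : ∀ i → side i ≡ part (splitAt 3 i)
side-splitAt zero                                = refl
side-splitAt (suc zero)                          = refl
side-splitAt (suc (suc zero))                    = refl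
side-splitAt (suc (suc (suc zero)))              = refl
side-splitAt (suc (suc (suc (suc zero))))        = refl
side-splitAt (suc (suc (suc (suc (suc zero)))))  = refl

K4-or-K33⇒union-closed : ∀ {n} (G : Graph n) → G ≅ K4 ⊎ G ≅ K33 → UnionClosed G
K4-or-K33⇒union-closed G (inj₁ iso) =
  multipartite⇒union-closed G (multipartite-pullback G K4 iso K4-multipartite)
K4-or-K33⇒union-closed G (inj₂ iso) =
  multipartite⇒union-closed G (multipartite-pullback G K33 iso K33-multipartite)

complete-≅K4 : ∀ {n} (G : Graph n) → n ≡ 4 → Multipartite G id → G ≅ K4
complete-≅K4 G refl complete =
  multipartite-≅ G K4 complete K4-multipartite id id (λ u → u , refl) (λ _ → refl)

order-from-degree : ∀ {n} → Fin n → n ∸ 1 ≡ 3 → n ≡ 4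
order-from-degree {suc m} _ m≡3 = cong suc m≡3

module _ {n : ℕ} (G : Graph n) (cubic : Cubic G) where

  some-neighbour : ∀ x → ∃ λ w → Adj G x w
  some-neighbour x with member (Nbhd G x) (cubic x)
  ... | w , w∈N = w , nbr⁻ G w∈N

  -- Neighbourhoods all have three elements, so one containing another equals it.
  nbhd-⊇⇒≡ : ∀ {x v} → Nbhd G x ⊆ Nbhd G v → Nbhd G v ≡ Nbhd G x
  nbhd-⊇⇒≡ {x} {v} Nx⊆Nv = ⊆-antisym (⊆-size-eq Nx⊆Nv (trans (cubic x) (sym (cubic v)))) Nx⊆Nv

  cl-nbhd : ∀ {x v} → v ∈ cl G x → Nbhd G v ≡ Nbhd G x
  cl-nbhd v∈cl = nbhd-⊇⇒≡ (cl-nbhd⊇ G v∈cl)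

  ⊥⊊cl : ∀ {x} → _⊊_ G ⊥ (cl G x)
  ⊥⊊cl = ⊊-witness G (⊆-min _) (x∈cl G) ∉⊥

  -- Hence every nonempty flat F ⊆ cl x is cl x: it contains some v, and cl v = cl x.
  cl-covers : ∀ {x} → Covers G (cl G x) ⊥
  cl-covers {x} = ⊥-flat G , cl-flat G , ⊥⊊cl , least
    where
    least : ∀ F → IsFlat G F → ⊥ ⊆ F → F ⊆ cl G x → F ≡ ⊥ ⊎ F ≡ cl G x
    least F fF _ F⊆cl with nonempty? F
    ... | no  F=∅       = inj₁ (Empty-unique F=∅)
    ... | yes (v , v∈F) = inj₂ (⊆-antisym F⊆cl
          (subst (_⊆ F) (cong (St G) (cl-nbhd (F⊆cl v∈F))) (cl-least G fF v∈F)))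

  cl-atom : ∀ {x} → IsAtom G (cl G x)
  cl-atom = ⊥ , ⊥-bottom G , cl-covers

  union-closed⇒geometric : UnionClosed G → Geometric G
  union-closed⇒geometric closed =
      modular⇒semimodular G (distributive⇒modular G (union-closed⇒distributive G closed))
    , λ X fX → map (cl G) (members G X)
             , map⁺ (universal (λ _ → cl-atom) _)
             , flat-is-join-of-closures G fX

  pentagon : ∀ {x y z u} → Separated G x y → Adj G y z → Adj G z u → u ∉ cl G y →
             Pentagon G ⊤ (Nbhd G z) (cl G y) (cl G x) ⊥ × Covers G (cl G x) ⊥
  pentagon {x} {y} {z} {u} sep y~z z~u u∉cly = record
    { fa = ⊤-flat G ; fb = Nbhd-flat G z ; fc = cl-flat G ; fd = cl-flat G ; fe = ⊥-flat G
    ; e<c = ⊥⊊cl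
    ; c<b = ⊊-witness G cly⊆Nz (nbr⁺ G z~u) u∉cly
    ; b<a = ⊊-witness G (⊆-max _) ∈⊤ (Adj-irrefl G ∘ nbr⁻ G)
    ; e<d = ⊥⊊cl
    ; d<a = ⊊-witness G (⊆-max _) ∈⊤ (nbr∉cl G (proj₂ (some-neighbour x)))
    ; d≢b = λ clx≡Nz → sep z (Adj-sym G (nbr⁻ G (subst (x ∈_) clx≡Nz (x∈cl G))) , y~z)
    ; d≢c = λ clx≡cly → sep z (nbr⁻ G (cl-nbhd⊇ G (subst (x ∈_) clx≡cly (x∈cl G)) (nbr⁺ G y~z)) , y~z)
    ; b∨d = join-⊤ G sep⁻¹ (nbr⁺ G (Adj-sym G y~z)) (x∈cl G)
    ; c∨d = join-⊤ G sep⁻¹ (x∈cl G) (x∈cl G)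
    ; b∧d = meet-⊥ G Nz∩clx=∅
    ; c∧d = meet-⊥ G (Nz∩clx=∅ ∘ cly⊆Nz)
    } , cl-covers
    where
    sep⁻¹ : Separated G y x
    sep⁻¹ w (y~w , x~w) = sep w (x~w , y~w)
    cly⊆Nz : cl G y ⊆ Nbhd G z
    cly⊆Nz v∈cl = nbr⁺ G (Adj-sym G (nbr⁻ G (cl-nbhd⊇ G v∈cl (nbr⁺ G y~z))))
    Nz∩clx=∅ : ∀ {v} → v ∈ Nbhd G z → v ∉ cl G x
    Nz∩clx=∅ v∈Nz v∈clx =
      sep z (nbr⁻ G (subst (z ∈_) (cl-nbhd v∈clx) (nbr⁺ G (Adj-sym G (nbr⁻ G v∈Nz)))) , y~z)

  record Star (c a b t : Fin n) : Set where
    field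
      c~a : Adj G c a
      c~b : Adj G c b
      c~t : Adj G c t
      a≢b : a ≢ b
      a≢t : a ≢ t
      b≢t : b ≢ t

    nbrs : ∀ {w} → Adj G c w → w ≡ a ⊎ w ≡ b ⊎ w ≡ t
    nbrs c~w = only-three (cubic c) (nbr⁺ G c~a) (nbr⁺ G c~b) (nbr⁺ G c~t) a≢b a≢t b≢t (nbr⁺ G c~w)

  star : ∀ {c a b} → Adj G c a → Adj G c b → a ≢ b → ∃ (Star c a b)
  star c~a c~b a≢b with third (cubic _) (nbr⁺ G c~a) (nbr⁺ G c~b) a≢b
  ... | t , t∈N , a≢t , b≢t = t , record
    { c~a = c~a ; c~b = c~b ; c~t = nbr⁻ G t∈N ; a≢b = a≢b ; a≢t = a≢t ; b≢t = b≢t }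

  swap : ∀ {c a b t} → Star c a b t → Star c b a t
  swap S = record { c~a = c~b ; c~b = c~a ; c~t = c~t ; a≢b = a≢b ∘ sym ; a≢t = b≢t ; b≢t = a≢t }
    where open Star S

  rotate : ∀ {c a b t} → Star c a b t → Star c t a b
  rotate S = record { c~a = c~t ; c~b = c~a ; c~t = c~b ; a≢b = a≢t ∘ sym ; a≢t = b≢t ∘ sym ; b≢t = a≢b }
    where open Star S

  star-at-t : ∀ {c u w t} → Star c u w t → Adj G u t → Adj G w t → Star t c u w
  star-at-t S u~t w~t = record
    { c~a = Adj-sym G c~t ; c~b = Adj-sym G u~t ; c~t = Adj-sym G w~t
    ; a≢b = Adj⇒≢ G c~a ; a≢t = Adj⇒≢ G c~b ; b≢t = a≢b }
    where open Star S

  module CommonNeighbours (common : ∀ x y → ∃ λ w → Adj G x w × Adj G y w) where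

    -- The common neighbour of c and a closes a triangle over the edge ca.
    triangle : ∀ {c a b t} → Star c a b t → Adj G a b ⊎ Adj G a t
    triangle {c} {a} S with common c a
    ... | m , c~m , a~m with Star.nbrs S c~m
    ... | inj₁ refl        = ⊥-elim (Adj-irrefl G a~m)
    ... | inj₂ (inj₁ refl) = inj₁ a~m
    ... | inj₂ (inj₂ refl) = inj₂ a~m

    -- If c has the neighbours u, w, t and both u and w are adjacent to t, then t has
    -- the neighbours c, u, w, and the third neighbour s of u, lying in a triangle
    -- with c or with t, must be w.
    closing : ∀ {c u w t} → Star c u w t → Adj G u t → Adj G w t → Adj G u w
    closing S u~t w~t with star (Adj-sym G (Star.c~a S)) u~t (Adj⇒≢ G (Star.c~t S))
    ... | s , U with triangle (rotate U)
    ... | inj₁ s~c with Star.nbrs S (Adj-sym G s~c)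
    ...   | inj₁ refl        = ⊥-elim (Adj-irrefl G (Star.c~t U))
    ...   | inj₂ (inj₁ refl) = Star.c~t U
    ...   | inj₂ (inj₂ refl) = ⊥-elim (Star.b≢t U refl)
    closing S u~t w~t | s , U | inj₂ s~t with Star.nbrs (star-at-t S u~t w~t) (Adj-sym G s~t)
    ...   | inj₁ refl        = ⊥-elim (Star.a≢t U refl)
    ...   | inj₂ (inj₁ refl) = ⊥-elim (Adj-irrefl G (Star.c~t U))
    ...   | inj₂ (inj₂ refl) = Star.c~t U

    -- G is complete, i.e. multipartite with one vertex per part: two distinct
    -- vertices u, w have a common neighbour c, and the triangles through cu and cw
    -- either contain the edge uw or close it up by `closing`.
    complete : Multipartite G id
    complete u w = mk⇔ (Adj⇒≢ G) adjacent
      where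
      adjacent : u ≢ w → Adj G u w
      adjacent u≢w with common u w
      ... | c , u~c , w~c with star (Adj-sym G u~c) (Adj-sym G w~c) u≢w
      ... | t , S with triangle S | triangle (swap S)
      ... | inj₁ u~w | _        = u~w
      ... | inj₂ _   | inj₁ w~u = Adj-sym G w~u
      ... | inj₂ u~t | inj₂ w~t = closing S u~t w~t

  -- A complete cubic graph has four vertices, as N(v) is everything but v.
  complete-order : Multipartite G id → Fin n → n ≡ 4
  complete-order complete v = order-from-degree v (begin
    n ∸ 1               ≡⟨ cong (n ∸_) (sym (∣⁅x⁆∣≡1 v)) ⟩
    n ∸ ∣ ⁅ v ⁆ ∣       ≡⟨ sym (∣∁p∣≡n∸∣p∣ ⁅ v ⁆) ⟩
    ∣ ∁ ⁅ v ⁆ ∣         ≡⟨ cong ∣_∣ (sym Nv≡∁v) ⟩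
    ∣ Nbhd G v ∣        ≡⟨ cubic v ⟩
    3                   ∎)
    where
    open ≡-Reasoning
    Nv≡∁v : Nbhd G v ≡ ∁ ⁅ v ⁆
    Nv≡∁v = ⊆-antisym
      (λ x∈N → x∉p⇒x∈∁p (x≢y⇒x∉⁅y⁆ (Adj⇒≢ G (nbr⁻ G x∈N) ∘ sym)))
      (λ x∈∁ → nbr⁺ G (Equivalence.from (complete v _) λ v≡x →
                 x∈∁p⇒x∉p x∈∁ (subst (_∈ ⁅ v ⁆) v≡x (x∈⁅x⁆ v))))

  K4-recognition : (∀ x y → ∃ λ w → Adj G x w × Adj G y w) → Fin n → G ≅ K4
  K4-recognition common v = complete-≅K4 G (complete-order complete v) complete
    where open CommonNeighbours common

  -- A connected cubic graph with an edge yz such that every neighbour of z lies in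
  -- cl y is K₃,₃, with sides Y = N(z) and Z = N(y).
  module Bipartite {y z} (connected : Connected G) (y~z : Adj G y z)
                   (closed : ∀ {u} → Adj G z u → u ∈ cl G y) where

    Y Z : Subset n
    Y = Nbhd G z
    Z = Nbhd G y

    Y-nbhd : ∀ {u} → u ∈ Y → Nbhd G u ≡ Z
    Y-nbhd u∈Y = cl-nbhd (closed (nbr⁻ G u∈Y))

    Y~Z : ∀ {u v} → u ∈ Y → v ∈ Z → Adj G u v
    Y~Z u∈Y v∈Z = nbr⁻ G (subst (_ ∈_) (sym (Y-nbhd u∈Y)) v∈Z)

    Z-nbhd : ∀ {v} → v ∈ Z → Nbhd G v ≡ Y
    Z-nbhd v∈Z = nbhd-⊇⇒≡ λ u∈Y → nbr⁺ G (Adj-sym G (Y~Z u∈Y v∈Z))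

    Y→Z : ∀ {u v} → u ∈ Y → Adj G u v → v ∈ Z
    Y→Z u∈Y u~v = subst (_ ∈_) (Y-nbhd u∈Y) (nbr⁺ G u~v)

    Z→Y : ∀ {u v} → u ∈ Z → Adj G u v → v ∈ Y
    Z→Y u∈Z u~v = subst (_ ∈_) (Z-nbhd u∈Z) (nbr⁺ G u~v)

    -- A vertex of Y ∩ Z would be adjacent to y, hence lie in N(y) with y ∈ N(y).
    Y∩Z=∅ : ∀ {u} → u ∈ Y → u ∉ Z
    Y∩Z=∅ u∈Y u∈Z = Adj-irrefl G (nbr⁻ G (Y→Z u∈Y (Adj-sym G (nbr⁻ G u∈Z))))

    -- Y ∪ Z contains y and is closed under neighbours, so by connectedness it is everything.
    Y∪Z : ∀ u → u ∈ Y ⊎ u ∈ Z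
    Y∪Z = connected-induction G connected (inj₁ (nbr⁺ G (Adj-sym G y~z))) inherit
      where
      inherit : ∀ {u v} → u ∈ Y ⊎ u ∈ Z → Adj G u v → v ∈ Y ⊎ v ∈ Z
      inherit (inj₁ u∈Y) u~v = inj₂ (Y→Z u∈Y u~v)
      inherit (inj₂ u∈Z) u~v = inj₁ (Z→Y u∈Z u~v)

    ∉Y⇒∈Z : ∀ {u} → u ∉ Y → u ∈ Z
    ∉Y⇒∈Z {u} u∉Y = [ (λ u∈Y → ⊥-elim (u∉Y u∈Y)) , id ]′ (Y∪Z u)

    inY : Fin n → Bool
    inY u = does (u ∈? Y)

    bipartite : Multipartite G inY
    bipartite u v with u ∈? Y | v ∈? Y
    ... | yes u∈Y | yes v∈Y = mk⇔ (λ u~v → ⊥-elim (Y∩Z=∅ v∈Y (Y→Z u∈Y u~v)))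
                                  (λ t≢t → ⊥-elim (t≢t refl))
    ... | yes u∈Y | no  v∉Y = mk⇔ (λ _ ()) (λ _ → Y~Z u∈Y (∉Y⇒∈Z v∉Y))
    ... | no  u∉Y | yes v∈Y = mk⇔ (λ _ ()) (λ _ → Adj-sym G (Y~Z v∈Y (∉Y⇒∈Z u∉Y)))
    ... | no  u∉Y | no  v∉Y = mk⇔ (λ u~v → ⊥-elim (v∉Y (Z→Y (∉Y⇒∈Z u∉Y) u~v)))
                                  (λ f≢f → ⊥-elim (f≢f refl))

    -- Enumerating Y and Z gives a bijection Fin 3 ⊎ Fin 3 → Fin n matching the sides of K₃,₃.
    ≅K33 : G ≅ K33
    ≅K33 = multipartite-≅ G K33 bipartite K33-multipartite (e ∘ splitAt 3) f-injective f-surjective parts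
      where
      module EY = Enumeration (enumerate {p = Y} (cubic z))
      module EZ = Enumeration (enumerate {p = Z} (cubic y))
      e : Fin 3 ⊎ Fin 3 → Fin n
      e = [ EY.elem , EZ.elem ]′
      e-injective : ∀ {p q} → e p ≡ e q → p ≡ q
      e-injective {inj₁ a} {inj₁ b} eq = cong inj₁ (EY.injective eq)
      e-injective {inj₁ a} {inj₂ b} eq = ⊥-elim (Y∩Z=∅ (EY.elem∈ a) (subst (_∈ Z) (sym eq) (EZ.elem∈ b)))
      e-injective {inj₂ a} {inj₁ b} eq = ⊥-elim (Y∩Z=∅ (EY.elem∈ b) (subst (_∈ Z) eq (EZ.elem∈ a)))
      e-injective {inj₂ a} {inj₂ b} eq = cong inj₂ (EZ.injective eq)
      e-surjective : ∀ u → ∃ λ p → e p ≡ u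
      e-surjective u =
        [ Data.Product.map inj₁ id ∘ EY.covers , Data.Product.map inj₂ id ∘ EZ.covers ]′ (Y∪Z u)
      f-injective : ∀ {i j} → e (splitAt 3 i) ≡ e (splitAt 3 j) → i ≡ j
      f-injective {i} {j} eq = begin
        i                       ≡⟨ sym (join-splitAt 3 3 i) ⟩
        join 3 3 (splitAt 3 i)  ≡⟨ cong (join 3 3) (e-injective {splitAt 3 i} {splitAt 3 j} eq) ⟩
        join 3 3 (splitAt 3 j)  ≡⟨ join-splitAt 3 3 j ⟩
        j                       ∎
        where open ≡-Reasoning
      f-surjective : ∀ u → ∃ λ i → e (splitAt 3 i) ≡ u
      f-surjective u with e-surjective u
      ... | p , ep≡u = join 3 3 p , trans (cong e (splitAt-join 3 3 p)) ep≡u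
      inY∘e : ∀ p → inY (e p) ≡ part p
      inY∘e (inj₁ a) = dec-true (_ ∈? Y) (EY.elem∈ a)
      inY∘e (inj₂ b) = dec-false (_ ∈? Y) (λ ∈Y → Y∩Z=∅ ∈Y (EZ.elem∈ b))
      parts : ∀ i → inY (e (splitAt 3 i)) ≡ side i
      parts i = trans (inY∘e (splitAt 3 i)) (sym (side-splitAt i))

  semimodular⇒K4-or-K33 : Connected G → Semimodular G → G ≅ K4 ⊎ G ≅ K33
  semimodular⇒K4-or-K33 connected semimodular
    with any? (λ x → any? (λ y → all? (λ w → ¬? (Adj? G x w ×-dec Adj? G y w))))
  ... | no none = inj₁ (K4-recognition common (proj₁ connected))
    where
    common : ∀ x y → ∃ λ w → Adj G x w × Adj G y w
    common x y with ¬∀⟶∃¬ n _ (λ w → ¬? (Adj? G x w ×-dec Adj? G y w)) (λ sep → none (x , y , sep))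
    ... | w , ¬sep = w , decidable-stable (Adj? G x w ×-dec Adj? G y w) ¬sep
  ... | yes (x , y , sep) with some-neighbour y
  ...   | z , y~z with any? (λ u → Adj? G z u ×-dec ¬? (u ∈? cl G y))
  ...     | yes (u , z~u , u∉cly) =
              ⊥-elim (semimodular (_ , _ , _ , _ , _ , pentagon sep y~z z~u u∉cly))
  ...     | no  none-outside = inj₂ (Bipartite.≅K33 connected y~z λ {u} z~u →
                         decidable-stable (u ∈? cl G y) (λ u∉cly → none-outside (u , z~u , u∉cly)))

theorem7p4 : ∀ (n : ℕ) (G : Graph n) → Cubic G → Connected G →
    let V = (G ≅ K4) ⊎ (G ≅ K33) in
    (Distributive G ⇔ V) × (Modular G ⇔ V) × (Semimodular G ⇔ V) × (Geometric G ⇔ V)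
theorem7p4 n G cubic connected =
    mk⇔ (classify ∘ semimodular ∘ modular) (distributive ∘ union-closed)
  , mk⇔ (classify ∘ semimodular) (modular ∘ distributive ∘ union-closed)
  , mk⇔ classify (semimodular ∘ modular ∘ distributive ∘ union-closed)
  , mk⇔ (classify ∘ proj₁) (union-closed⇒geometric G cubic ∘ union-closed)
  where
  classify : Semimodular G → G ≅ K4 ⊎ G ≅ K33
  classify = semimodular⇒K4-or-K33 G cubic connected
  union-closed : G ≅ K4 ⊎ G ≅ K33 → UnionClosed G
  union-closed = K4-or-K33⇒union-closed G
  distributive : UnionClosed G → Distributive G
  distributive = union-closed⇒distributive G
  modular : Distributive G → Modular G
  modular = distributive⇒modular G
  semimodular : Modular G → Semimodular G
  semimodular = modular⇒semimodular G
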